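{- Let $d\ge 2$ and $\ell\ge 2$ be integers and let $\Gamma=B(d,\ell)$ be the De Bruijn digraph. Fix $x_1,\ldots,x_{\ell-1}\in\mathbb{Z}_d$, not all equal, and let $X=\{x_1x_2\ldots x_{\ell-1}k : k\in\mathbb{Z}_d\}$. For each $j\in\mathbb{Z}_d$ let $\alpha_j$ be a permutation of $\mathbb{Z}_d=\{0,1,\ldots,d-1\}$. Let $\Gamma'=B'(d,\ell)$ be the digraph obtained from $\Gamma$ by changing only the out-going arcs of the vertices of $X$, so that each vertex $x_1x_2\ldots x_{\ell-1}k\in X$ is adjacent (exactly) to the $d$ vertices $x_2x_3\ldots x_{\ell-1}\alpha_j(k)j$, $j=0,1,\ldots,d-1$. Then $\Gamma'$ is a $d$-regular digraph with diameter $\ell$ (the same as $B(d,\ell)$), and $\Gamma'$ is $\ell$-reachable.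
   Context: The De Bruijn digraph $B(d,\ell)$ has as vertices all words $y_1y_2\ldots y_\ell$ of length $\ell$ over the alphabet $\mathbb{Z}_d=\{0,1,\ldots,d-1\}$, with an arc from $y_1\ldots y_\ell$ to $y_2\ldots y_\ell z$ for every $z\in\mathbb{Z}_d$ (the last $\ell-1$ symbols of the tail equal the first $\ell-1$ symbols of the head). A digraph is $d$-regular if every vertex has in-degree and out-degree $d$. A digraph is $\ell$-reachable if $\ell$ is the smallest integer $m$ such that for every ordered pair of vertices $u,v$ there is a walk of length exactly $m$ from $u$ to $v$. The diameter is the maximum over ordered pairs of vertices of the length of a shortest directed walk between them. -}

module Defs where

open import Data.Nat using (ℕ; zero; suc; _≤_)
open import Data.Fin using (Fin)
open import Data.Vec using (Vec; _∷_; _∷ʳ_; tail)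
open import Data.List using (List; length)
open import Data.List.Membership.Propositional using (_∈_)
open import Data.List.Relation.Unary.Unique.Propositional using (Unique)
open import Data.Product using (Σ; ∃; ∃-syntax; _×_)
open import Data.Sum using (_⊎_)
open import Relation.Nullary using (¬_)
open import Relation.Binary.PropositionalEquality using (_≡_)
open import Function.Bundles using (_⇔_)
open import Data.Fin.Permutation using (Permutation′; _⟨$⟩ʳ_)

Word : ℕ → ℕ → Set
Word d n = Vec (Fin d) n

BArc : ∀ {d n} → Word d (suc n) → Word d (suc n) → Set
BArc {d} (y ∷ ys) v = ∃[ z ] v ≡ ys ∷ʳ z

InX : ∀ {d m} → Word d (suc m) → Word d (suc (suc m)) → Set
InX x u = ∃[ k ] u ≡ x ∷ʳ k

-- Arcs of B'(d,ℓ), ℓ = m + 2: vertices of X (u = x₁…x_{ℓ-1}k) go to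
-- x₂…x_{ℓ-1} α_j(k) j for j ∈ Z_d; all other vertices keep their De Bruijn arcs.
B'Arc : ∀ {d m} → Word d (suc m) → (Fin d → Permutation′ d) →
        Word d (suc (suc m)) → Word d (suc (suc m)) → Set
B'Arc {d} x α u v =
  (∃[ k ] (u ≡ x ∷ʳ k × ∃[ j ] v ≡ (tail x ∷ʳ (α j ⟨$⟩ʳ k)) ∷ʳ j))
  ⊎ ((¬ InX x u) × BArc u v)

data Walk {V : Set} (A : V → V → Set) : V → V → ℕ → Set where
  []  : ∀ {u} → Walk A u u 0
  _∷_ : ∀ {u w v k} → A u w → Walk A w v k → Walk A u v (suc k)

OutDegree : {V : Set} → (V → V → Set) → V → ℕ → Set
OutDegree {V} A u n =
  Σ (List V) λ L → Unique L × length L ≡ n × (∀ v → (v ∈ L) ⇔ A u v)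

InDegree : {V : Set} → (V → V → Set) → V → ℕ → Set
InDegree {V} A v n =
  Σ (List V) λ L → Unique L × length L ≡ n × (∀ u → (u ∈ L) ⇔ A u v)

Regular : {V : Set} → (V → V → Set) → ℕ → Set
Regular A n = ∀ u → OutDegree A u n × InDegree A u n

Diameter : {V : Set} → (V → V → Set) → ℕ → Set
Diameter {V} A D =
  (∀ u v → ∃[ k ] (k ≤ D × Walk A u v k))
  × (∃[ u ] ∃[ v ] ∀ k → Walk A u v k → D ≤ k)

Reachable : {V : Set} → (V → V → Set) → ℕ → Set
Reachable {V} A ℓ =
  (∀ u v → Walk A u v ℓ)
  × (∀ m → (∀ u v → Walk A u v m) → ℓ ≤ m)

-- Outside X the arcs are those of B(d,ℓ), so a walk of length ℓ from u to
-- c₁…c_ℓ can shift in c₁,…,c_ℓ one letter per step.  A step out of an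
-- X-vertex x k writes α_j(k) instead of k; but as x is not constant no arc
-- joins two vertices of X, so the arc entering x k may be redirected to any
-- x k′, and k′ = α_j⁻¹(k) restores the intended letter.  Conversely every arc
-- shortens a leading run 0…0 by one letter (again because x is not constant),
-- so every walk from 0^ℓ to 1^ℓ has length at least ℓ.
module Submission where

open import Defs
open import Data.Nat using (ℕ; zero; suc; _+_; _≤_; z≤n; s≤s)
open import Data.Nat.Properties using (≤-refl; ≮⇒≥; +-comm)
open import Data.Fin as Fin using (Fin) renaming (_≟_ to _≟ᶠ_)
open import Data.Vec using (Vec; []; _∷_; _∷ʳ_; head; tail; lookup; replicate; toList; initLast)
open import Data.Vec.Properties
  using (≡-dec; ∷-injective; ∷-injectiveˡ; ∷ʳ-injective; ∷ʳ-injectiveˡ; ∷ʳ-injectiveʳ; toList-injective; toList-∷ʳ; length-toList)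
open import Data.Vec.Relation.Unary.All using (All; []; _∷_)
open import Data.Vec.Relation.Unary.All.Properties using (lookup⁺)
open import Data.Vec.Relation.Binary.Equality.Cast using (cast-is-id)
open import Data.List as List using (List; length; tabulate; drop; _++_)
open import Data.List.Properties using (length-tabulate; ++-assoc; ++-identityʳ)
open import Data.List.Membership.Propositional using (_∈_)
open import Data.List.Membership.Propositional.Properties using (∈-tabulate⁺; ∈-tabulate⁻)
open import Data.List.Relation.Unary.Unique.Propositional using (Unique)
open import Data.List.Relation.Unary.Unique.Propositional.Properties using (tabulate⁺)
open import Data.Fin.Permutation using (Permutation′; _⟨$⟩ʳ_; _⟨$⟩ˡ_; inverseʳ; inverseˡ)
open import Data.Product using (Σ; ∃; _×_; _,_)
open import Data.Sum using (_⊎_; inj₁; inj₂)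
open import Data.Empty using (⊥-elim)
open import Function using (id; _∘_)
open import Function.Bundles using (_⇔_; mk⇔)
open import Relation.Nullary using (¬_; Dec; yes; no)
open import Relation.Binary.PropositionalEquality
  using (_≡_; _≢_; refl; sym; trans; cong; subst; module ≡-Reasoning)

tabulate-enumerates : ∀ {V : Set} {n} {P : V → Set} (f : Fin n → V) →
  (∀ {i j} → f i ≡ f j → i ≡ j) → (∀ i → P (f i)) → (∀ v → P v → ∃ λ i → f i ≡ v) →
  Σ (List V) λ L → Unique L × length L ≡ n × (∀ v → (v ∈ L) ⇔ P v)
tabulate-enumerates {P = P} f f-injective P-f P⇒image =
  tabulate f , tabulate⁺ f-injective , length-tabulate f , λ v → mk⇔ (∈⇒P v) (∈-image v)
  where
  ∈⇒P : ∀ v → v ∈ tabulate f → P v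
  ∈⇒P v v∈ with ∈-tabulate⁻ v∈
  ... | i , refl = P-f i

  ∈-image : ∀ v → P v → v ∈ tabulate f
  ∈-image v Pv with P⇒image v Pv
  ... | i , refl = ∈-tabulate⁺ i

module _ {a} {A : Set a} where

  Constant : ∀ {n} → Vec A n → Set a
  Constant v = ∀ i j → lookup v i ≡ lookup v j

  All≡⇒constant : ∀ {n c} {v : Vec A n} → All (_≡ c) v → Constant v
  All≡⇒constant all i j = trans (lookup⁺ all i) (sym (lookup⁺ all j))

  ∷ʳ≡∷⇒All≡ : ∀ {n} y (ys : Vec A n) c → ys ∷ʳ c ≡ y ∷ ys → All (_≡ c) (y ∷ ys)
  ∷ʳ≡∷⇒All≡ y []       c eq = sym (∷-injectiveˡ eq) ∷ []
  ∷ʳ≡∷⇒All≡ y (z ∷ zs) c eq with ∷-injective eq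
  ... | z≡y , eq′ with ∷ʳ≡∷⇒All≡ z zs c eq′
  ...   | z≡c ∷ zs≡c = trans (sym z≡y) z≡c ∷ z≡c ∷ zs≡c

  tail-∷ʳ≡⇒constant : ∀ {n} (v : Vec A (suc n)) c → tail v ∷ʳ c ≡ v → Constant v
  tail-∷ʳ≡⇒constant (y ∷ ys) c eq = All≡⇒constant (∷ʳ≡∷⇒All≡ y ys c eq)

  head-∷ʳ : ∀ {n} (v : Vec A (suc n)) c → head (v ∷ʳ c) ≡ head v
  head-∷ʳ (y ∷ ys) c = refl

  head-∷-tail : ∀ {n} (v : Vec A (suc n)) → head v ∷ tail v ≡ v
  head-∷-tail (y ∷ ys) = refl

  pushAll : ∀ {n k} → Vec A (suc n) → Vec A k → Vec A (suc n)
  pushAll w []       = w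
  pushAll w (c ∷ cs) = pushAll (tail w ∷ʳ c) cs

  drop-length-++ : ∀ (l r : List A) → drop (length l) (l ++ r) ≡ r
  drop-length-++ List.[]      r = refl
  drop-length-++ (_ List.∷ l) r = drop-length-++ l r

  toList-∷ʳ-++ : ∀ {n} (q : Vec A n) c l → toList (q ∷ʳ c) ++ l ≡ toList q ++ c List.∷ l
  toList-∷ʳ-++ q c l = trans (cong (_++ l) (toList-∷ʳ c q)) (++-assoc (toList q) List.[ c ] l)

  toList-pushAll : ∀ {n k} (w : Vec A (suc n)) (cs : Vec A k) →
    toList (pushAll w cs) ≡ drop k (toList w ++ toList cs)
  toList-pushAll w [] = sym (++-identityʳ (toList w))
  toList-pushAll {k = suc k} (y ∷ ys) (c ∷ cs) =
    trans (toList-pushAll (ys ∷ʳ c) cs) (cong (drop k) (toList-∷ʳ-++ ys c (toList cs)))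

  pushAll-∷ʳ : ∀ {n} (q cs : Vec A n) c → pushAll (q ∷ʳ c) cs ≡ c ∷ cs
  pushAll-∷ʳ {n} q cs c = trans (sym (cast-is-id refl _)) (toList-injective refl _ _ (begin
    toList (pushAll (q ∷ʳ c) cs)                   ≡⟨ toList-pushAll (q ∷ʳ c) cs ⟩
    drop n (toList (q ∷ʳ c) ++ toList cs)          ≡⟨ cong (drop n) (toList-∷ʳ-++ q c (toList cs)) ⟩
    drop n (toList q ++ c List.∷ toList cs)        ≡⟨ cong (λ k → drop k (toList q ++ c List.∷ toList cs))
                                                           (sym (length-toList q)) ⟩
    drop (length (toList q)) (toList q ++ c List.∷ toList cs) ≡⟨ drop-length-++ (toList q) _ ⟩
    c List.∷ toList cs                             ∎))
    where open ≡-Reasoning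

  data LeadingRun (o : A) : ∀ {n} → ℕ → Vec A n → Set a where
    done : ∀ {n} {v : Vec A n} → LeadingRun o 0 v
    step : ∀ {n t} {v : Vec A n} → LeadingRun o t v → LeadingRun o (suc t) (o ∷ v)

  module _ {o : A} where

    leadingRun-head : ∀ {n t c} {v : Vec A n} → LeadingRun o (suc t) (c ∷ v) → c ≡ o
    leadingRun-head (step _) = refl

    leadingRun-tail : ∀ {n t} {v : Vec A (suc n)} → LeadingRun o (suc t) v → LeadingRun o t (tail v)
    leadingRun-tail (step run) = run

    leadingRun-∷ʳ : ∀ {n t c} {v : Vec A n} → LeadingRun o t v → LeadingRun o t (v ∷ʳ c)
    leadingRun-∷ʳ done       = done
    leadingRun-∷ʳ (step run) = step (leadingRun-∷ʳ run)

    leadingRun-∷ʳ⁻ : ∀ {n t c} (v : Vec A n) → LeadingRun o t (v ∷ʳ c) → LeadingRun o t v ⊎ All (_≡ o) v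
    leadingRun-∷ʳ⁻ []       _          = inj₂ []
    leadingRun-∷ʳ⁻ (y ∷ ys) done       = inj₁ done
    leadingRun-∷ʳ⁻ (y ∷ ys) (step run) with leadingRun-∷ʳ⁻ ys run
    ... | inj₁ run′ = inj₁ (step run′)
    ... | inj₂ all  = inj₂ (refl ∷ all)

    leadingRun-replicate : ∀ {n t} → t ≤ n → LeadingRun o t (replicate n o)
    leadingRun-replicate z≤n       = done
    leadingRun-replicate (s≤s t≤n) = step (leadingRun-replicate t≤n)

module ModifiedDeBruijn {d m : ℕ} (x : Word d (suc m)) (α : Fin d → Permutation′ d)
                        (x-nonconstant : ¬ Constant x) where

  Vertex : Set
  Vertex = Word d (suc (suc m))

  _⟶_ : Vertex → Vertex → Set
  _⟶_ = B'Arc x α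

  _≟ʷ_ : ∀ {n} (u v : Word d n) → Dec (u ≡ v)
  _≟ʷ_ = ≡-dec _≟ᶠ_

  tail-x∷ʳ≢x : ∀ c → tail x ∷ʳ c ≢ x
  tail-x∷ʳ≢x c = x-nonconstant ∘ tail-∷ʳ≡⇒constant x c

  ∉X : ∀ {p} b → p ≢ x → ¬ InX x (p ∷ʳ b)
  ∉X {p} b p≢x (k , eq) = p≢x (∷ʳ-injectiveˡ p x eq)

  X-arc : ∀ k j → (x ∷ʳ k) ⟶ ((tail x ∷ʳ (α j ⟨$⟩ʳ k)) ∷ʳ j)
  X-arc k j = inj₁ (k , refl , j , refl)

  de-Bruijn-arc : ∀ {p} → p ≢ x → ∀ b j → (p ∷ʳ b) ⟶ ((tail p ∷ʳ b) ∷ʳ j)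
  de-Bruijn-arc {y ∷ ys} p≢x b j = inj₂ (∉X b p≢x , j , refl)

  BArc⇒shift : ∀ (p : Word d (suc m)) b {v} → BArc (p ∷ʳ b) v → ∃ λ j → (tail p ∷ʳ b) ∷ʳ j ≡ v
  BArc⇒shift (y ∷ ys) b (j , refl) = j , refl

  out-degree : ∀ u → OutDegree _⟶_ u d
  out-degree u with initLast u
  ... | p , b , refl with p ≟ʷ x
  ...   | yes refl = tabulate-enumerates (λ j → (tail x ∷ʳ (α j ⟨$⟩ʳ b)) ∷ʳ j)
                       (∷ʳ-injectiveʳ _ _) (X-arc b) image
    where
    image : ∀ v → (x ∷ʳ b) ⟶ v → ∃ λ j → (tail x ∷ʳ (α j ⟨$⟩ʳ b)) ∷ʳ j ≡ v
    image v (inj₁ (k , eq , j , refl)) with ∷ʳ-injectiveʳ x x eq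
    ... | refl = j , refl
    image v (inj₂ (x∷ʳb∉X , _)) = ⊥-elim (x∷ʳb∉X (b , refl))
  ...   | no p≢x = tabulate-enumerates (λ j → (tail p ∷ʳ b) ∷ʳ j)
                     (∷ʳ-injectiveʳ _ _) (de-Bruijn-arc p≢x b) image
    where
    image : ∀ v → (p ∷ʳ b) ⟶ v → ∃ λ j → (tail p ∷ʳ b) ∷ʳ j ≡ v
    image v (inj₁ (k , eq , _)) = ⊥-elim (p≢x (∷ʳ-injectiveˡ p x eq))
    image v (inj₂ (_ , shift)) = BArc⇒shift p b shift

  -- The in-neighbours of (q a) j, indexed by their first letter z.
  predecessor : Word d m → Fin d → Fin d → Fin d → Vertex
  predecessor q a j z with (z ∷ q) ≟ʷ x
  ... | yes _ = x ∷ʳ (α j ⟨$⟩ˡ a)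
  ... | no _  = z ∷ (q ∷ʳ a)

  head-predecessor : ∀ q a j z → head (predecessor q a j z) ≡ z
  head-predecessor q a j z with (z ∷ q) ≟ʷ x
  ... | yes z∷q≡x = trans (head-∷ʳ x _) (sym (cong head z∷q≡x))
  ... | no _      = refl

  predecessor-injective : ∀ q a j {z z′} → predecessor q a j z ≡ predecessor q a j z′ → z ≡ z′
  predecessor-injective q a j {z} {z′} eq =
    trans (sym (head-predecessor q a j z)) (trans (cong head eq) (head-predecessor q a j z′))

  predecessor-arc : ∀ q a j z → predecessor q a j z ⟶ ((q ∷ʳ a) ∷ʳ j)
  predecessor-arc q a j z with (z ∷ q) ≟ʷ x
  ... | yes refl = subst (λ e → (x ∷ʳ (α j ⟨$⟩ˡ a)) ⟶ ((q ∷ʳ e) ∷ʳ j)) (inverseʳ (α j)) (X-arc _ j)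
  ... | no z∷q≢x = de-Bruijn-arc z∷q≢x a j

  arc⇒predecessor : ∀ q a j u → u ⟶ ((q ∷ʳ a) ∷ʳ j) → ∃ λ z → predecessor q a j z ≡ u
  arc⇒predecessor q a j u (inj₁ (k , refl , j′ , eq)) with ∷ʳ-injective _ _ eq
  ... | eq′ , refl with ∷ʳ-injective _ _ eq′
  ... | refl , refl = head x , predecessor-of-x
    where
    predecessor-of-x : predecessor (tail x) (α j ⟨$⟩ʳ k) j (head x) ≡ x ∷ʳ k
    predecessor-of-x with (head x ∷ tail x) ≟ʷ x
    ... | yes _  = cong (x ∷ʳ_) (inverseˡ (α j))
    ... | no neq = ⊥-elim (neq (head-∷-tail x))
  arc⇒predecessor q a j (y ∷ ys) (inj₂ (u∉X , j′ , eq)) with ∷ʳ-injectiveˡ _ _ eq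
  ... | refl = y , predecessor-of-u
    where
    predecessor-of-u : predecessor q a j y ≡ y ∷ (q ∷ʳ a)
    predecessor-of-u with (y ∷ q) ≟ʷ x
    ... | yes y∷q≡x = ⊥-elim (u∉X (a , cong (_∷ʳ a) y∷q≡x))
    ... | no _      = refl

  in-degree : ∀ v → InDegree _⟶_ v d
  in-degree v with initLast v
  ... | w , j , refl with initLast w
  ...   | q , a , refl =
    tabulate-enumerates (predecessor q a j) (predecessor-injective q a j)
      (predecessor-arc q a j) (arc⇒predecessor q a j)

  redirect-into-X : ∀ {u} c c′ → u ⟶ (x ∷ʳ c) → u ⟶ (x ∷ʳ c′)
  redirect-into-X c c′ (inj₁ (k , refl , j , eq)) = ⊥-elim (tail-x∷ʳ≢x _ (sym (∷ʳ-injectiveˡ _ _ eq)))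
  redirect-into-X {y ∷ ys} c c′ (inj₂ (u∉X , j , eq)) =
    inj₂ (u∉X , c′ , cong (_∷ʳ c′) (∷ʳ-injectiveˡ _ _ eq))

  sibling-shifting-in : ∀ q c c′ →
    ∃ λ c* → (∀ {u} → u ⟶ (q ∷ʳ c) → u ⟶ (q ∷ʳ c*)) × (q ∷ʳ c*) ⟶ ((tail q ∷ʳ c) ∷ʳ c′)
  sibling-shifting-in q c c′ with q ≟ʷ x
  ... | yes refl = α c′ ⟨$⟩ˡ c , redirect-into-X c _ ,
                   subst (λ e → (x ∷ʳ (α c′ ⟨$⟩ˡ c)) ⟶ ((tail x ∷ʳ e) ∷ʳ c′)) (inverseʳ (α c′)) (X-arc _ c′)
  ... | no q≢x   = c , id , de-Bruijn-arc q≢x c c′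

  walk-pushAll : ∀ {k u c} q (cs : Word d k) → u ⟶ (q ∷ʳ c) → Walk _⟶_ u (pushAll (q ∷ʳ c) cs) (suc k)
  walk-pushAll q [] arc = arc ∷ []
  walk-pushAll {c = c} (q₀ ∷ q) (c′ ∷ cs) arc with sibling-shifting-in (q₀ ∷ q) c c′
  ... | c* , redirect , arc′ = redirect arc ∷ walk-pushAll (q ∷ʳ c) cs arc′

  arc-ending-in : ∀ u j → ∃ λ q → u ⟶ (q ∷ʳ j)
  arc-ending-in u j with initLast u
  ... | p , b , refl with p ≟ʷ x
  ...   | yes refl = _ , X-arc b j
  ...   | no p≢x   = _ , de-Bruijn-arc p≢x b j

  walk : ∀ u v → Walk _⟶_ u v (suc (suc m))
  walk u (c ∷ cs) with arc-ending-in u c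
  ... | q , arc = subst (λ v → Walk _⟶_ u v _) (pushAll-∷ʳ q cs c) (walk-pushAll q cs arc)

  arc-shortens-run : ∀ {o t w w′} → w ⟶ w′ → LeadingRun o (suc t) w → LeadingRun o t w′
  arc-shortens-run (inj₁ (k , refl , j , refl)) run with leadingRun-∷ʳ⁻ x run
  ... | inj₁ run-x = leadingRun-∷ʳ (leadingRun-∷ʳ (leadingRun-tail run-x))
  ... | inj₂ all   = ⊥-elim (x-nonconstant (All≡⇒constant all))
  arc-shortens-run {w = y ∷ ys} (inj₂ (_ , j , refl)) run = leadingRun-∷ʳ (leadingRun-tail run)

  walk-shortens-run : ∀ {o k t w v} → Walk _⟶_ w v k → LeadingRun o (k + t) w → LeadingRun o t v
  walk-shortens-run []           run = run
  walk-shortens-run (arc ∷ rest) run = walk-shortens-run rest (arc-shortens-run arc run)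

  walk-length-≥ : ∀ {o o′ k} → o ≢ o′ →
    Walk _⟶_ (replicate _ o) (replicate _ o′) k → suc (suc m) ≤ k
  walk-length-≥ {k = k} o≢o′ w = ≮⇒≥ λ k<ℓ →
    let run-source = leadingRun-replicate (subst (_≤ suc (suc m)) (+-comm 1 k) k<ℓ)
    in o≢o′ (sym (leadingRun-head (walk-shortens-run {t = 1} w run-source)))

proposition3 : (d m : ℕ) → 2 ≤ d →
    (x : Word d (suc m)) → ¬ (∀ i j → lookup x i ≡ lookup x j) →
    (α : Fin d → Permutation′ d) →
    Regular (B'Arc x α) d
    × Diameter (B'Arc x α) (suc (suc m))
    × Reachable (B'Arc x α) (suc (suc m))
proposition3 (suc (suc d)) m (s≤s (s≤s z≤n)) x x-nonconstant α =
  (λ u → out-degree u , in-degree u) ,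
  ((λ u v → _ , ≤-refl , walk u v) , zeros , ones , λ _ → walk-length-≥ 0≢1) ,
  walk , λ _ walks → walk-length-≥ 0≢1 (walks zeros ones)
  where
  open ModifiedDeBruijn x α x-nonconstant

  0≢1 : Fin.zero ≢ Fin.suc Fin.zero
  0≢1 ()

  zeros ones : Vertex
  zeros = replicate _ Fin.zero
  ones  = replicate _ (Fin.suc Fin.zero)
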